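{- Let $\mathcal{T}$ be a $k$-tree with $k\ge3$. Then $0$ is an eigenvalue of the adjacency tensor $\mathcal{A}(\mathcal{T})$.
   Context: A $k$-graph has a finite vertex set and an edge set of $k$-element vertex subsets; a $k$-tree is a connected $k$-graph without cycles. For a $k$-graph on vertices $v_1,\dots,v_n$, the adjacency tensor $\mathcal{A}=(a_{i_1\dots i_k})$ has $a_{i_1\dots i_k}=\frac{1}{(k-1)!}$ if $\{v_{i_1},\dots,v_{i_k}\}$ is an edge and $0$ otherwise; $\lambda\in\mathbb{C}$ is an eigenvalue if some nonzero $\mathbf{x}\in\mathbb{C}^n$ satisfies $\sum_{i_2,\dots,i_k}a_{ii_2\dots i_k}\mathbf{x}_{i_2}\cdots\mathbf{x}_{i_k}=\lambda\mathbf{x}_i^{k-1}$ for all $i$. -}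

module Defs where

open import Level using (Level)
open import Data.Nat using (ℕ; zero; suc; pred; _≤_)
open import Data.Fin using (Fin; zero; suc; inject₁; fromℕ)
open import Data.Fin.Subset using (Subset; ⁅_⁆; _∪_; ∣_∣) renaming (⊥ to ∅; _∈_ to _∈ₛ_)
open import Data.Vec using (Vec; []; _∷_)
open import Data.Vec.Properties using (≡-dec)
open import Data.Bool using (Bool)
open import Data.Bool.Properties renaming (_≟_ to _≟B_)
open import Data.List using (List; length; lookup)
open import Data.List.Relation.Unary.All using (All)
open import Data.List.Relation.Unary.Unique.Propositional using (Unique)
open import Data.List.Relation.Unary.Any using (any?)
open import Data.List.Membership.Propositional using () renaming (_∈_ to _∈ₗ_)
open import Data.Product using (Σ; ∃; _×_; _,_)
open import Relation.Binary.PropositionalEquality using (_≡_)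
open import Relation.Nullary using (¬_; yes; no)
open import Function.Definitions using (Injective)
open import Algebra.Bundles using (CommutativeRing)

record KGraph (n k : ℕ) : Set where
  field
    edges      : List (Subset n)
    edgesDistinct : Unique edges
    edgesSize  : All (λ e → ∣ e ∣ ≡ k) edges
open KGraph public

data Reach {n k : ℕ} (G : KGraph n k) : Fin n → Fin n → Set where
  here : ∀ {u} → Reach G u u
  step : ∀ {u v w} (e : Subset n) → e ∈ₗ edges G → u ∈ₛ e → v ∈ₛ e →
         Reach G v w → Reach G u w

Connected : ∀ {n k} → KGraph n k → Set
Connected G = ∀ u w → Reach G u w

edgeAt : ∀ {n k} (G : KGraph n k) → Fin (length (edges G)) → Subset n
edgeAt G i = lookup (edges G) i

-- A (Berge) cycle of length t = l + 2 ≥ 2: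
-- v₀ e₀ v₁ e₁ … v_{t-1} e_{t-1} v₀ with distinct vertices, distinct edges,
-- v_j, v_{j+1} ∈ e_j (indices mod t).
record Cycle {n k : ℕ} (G : KGraph n k) (l : ℕ) : Set where
  field
    vs      : Fin (suc (suc l)) → Fin n
    es      : Fin (suc (suc l)) → Fin (length (edges G))
    vsInj   : Injective _≡_ _≡_ vs
    esInj   : Injective _≡_ _≡_ es
    inCur   : ∀ j → vs j ∈ₛ edgeAt G (es j)
    inNext  : ∀ (j : Fin (suc l)) → vs (suc j) ∈ₛ edgeAt G (es (inject₁ j))
    inClose : vs zero ∈ₛ edgeAt G (es (fromℕ (suc l)))

Acyclic : ∀ {n k} → KGraph n k → Set
Acyclic G = ∀ l → ¬ Cycle G l

IsKTree : ∀ {n k} → KGraph n k → Set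
IsKTree G = Connected G × Acyclic G

image : ∀ {n l} → Vec (Fin n) l → Subset n
image []       = ∅
image (x ∷ xs) = ⁅ x ⁆ ∪ image xs

module _ {c ℓ} (R : CommutativeRing c ℓ) where
  open CommutativeRing R using (Carrier; _≈_; _+_; _*_; 0#; 1#)

  natR : ℕ → Carrier
  natR zero    = 0#
  natR (suc m) = 1# + natR m

  pow : Carrier → ℕ → Carrier
  pow x zero    = 1#
  pow x (suc m) = x * pow x m

  sumFin : ∀ n → (Fin n → Carrier) → Carrier
  sumFin zero    f = 0#
  sumFin (suc n) f = f zero + sumFin n (λ j → f (suc j))

  sumTuples : ∀ {n} m → (Vec (Fin n) m → Carrier) → Carrier
  sumTuples zero    f = f []
  sumTuples {n} (suc m) f = sumFin n (λ j → sumTuples m (λ v → f (j ∷ v)))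

  prodTuple : ∀ {n m} → (Fin n → Carrier) → Vec (Fin n) m → Carrier
  prodTuple x []       = 1#
  prodTuple x (i ∷ is) = x i * prodTuple x is

  -- adjacency tensor entry a_{i_1 … i_k}; the argument `inv` plays the role
  -- of the scalar 1/(k-1)!.  Entry is inv if {v_{i_1},…,v_{i_k}} is an edge.
  adjTensor : ∀ {n k} → KGraph n k → (inv : Carrier) → Vec (Fin n) k → Carrier
  adjTensor G inv t with any? (λ e → ≡-dec _≟B_ (image t) e) (edges G)
  ... | yes _ = inv
  ... | no  _ = 0#

  -- the i-th coordinate of 𝒜 x^{k-1}, i.e. Σ_{i_2,…,i_k} a_{i i_2 … i_k} x_{i_2}⋯x_{i_k}.
  -- (For k = 0 there are no tensor entries; this degenerate case is never used.)
  tensorApply : ∀ {n k} → KGraph n k → (inv : Carrier) → (Fin n → Carrier) → Fin n → Carrier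
  tensorApply {n} {zero}  G inv x i = 0#
  tensorApply {n} {suc m} G inv x i =
    sumTuples m (λ rest → adjTensor G inv (i ∷ rest) * prodTuple x rest)

  IsEigenvalue : ∀ {n k} → KGraph n k → (inv : Carrier) → Carrier → Set (c Level.⊔ ℓ)
  IsEigenvalue {n} {k} G inv lam =
    Σ (Fin n → Carrier) λ x →
      (∃ λ i → ¬ (x i ≈ 0#)) ×
      (∀ (i : Fin n) → tensorApply G inv x i ≈ lam * pow (x i) (pred k))

{-# OPTIONS --safe #-}
-- A monomial x_{i_2}⋯x_{i_k} evaluated at e_v is
-- nonzero only if i_2 = ⋯ = i_k = v, and then {v_i, v_{i_2}, …, v_{i_k}} has at
-- most 2 < k elements, so it is not an edge and the tensor entry vanishes.
module Submission where

open import Defs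
open import Data.Nat using (ℕ; _≤_; pred; _!; suc; _+_; s≤s; z≤n)
open import Data.Nat.Properties using (≤-trans; +-suc; +-monoʳ-≤; +-mono-≤; n≤1+n; ≤-reflexive)
open import Data.Fin using (Fin; _≟_)
open import Data.Fin.Subset using (Subset; ⁅_⁆; _∪_; ∣_∣; _⊆_; inside; outside)
open import Data.Fin.Subset.Properties using (⊥⊆; x∈p∪q⁻; p⊆q⇒∣p∣≤∣q∣; ∣⁅x⁆∣≡1)
open import Data.Vec using (Vec; []; _∷_)
open import Data.Vec.Properties using (≡-dec)
open import Data.Bool.Properties using () renaming (_≟_ to _≟B_)
open import Data.List.Relation.Unary.All as All using ()
open import Data.List.Relation.Unary.Any using (any?)
open import Data.Sum using (_⊎_; inj₁; inj₂; [_,_])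
open import Data.Product using (_,_)
open import Function using (id)
open import Relation.Nullary using (¬_; yes; no; contradiction)
open import Relation.Binary.PropositionalEquality using (refl; _≢_; subst; sym)
open import Algebra.Bundles using (CommutativeRing)

∣p∪q∣≤∣p∣+∣q∣ : ∀ {n} (p q : Subset n) → ∣ p ∪ q ∣ ≤ ∣ p ∣ + ∣ q ∣
∣p∪q∣≤∣p∣+∣q∣ []            []            = z≤n
∣p∪q∣≤∣p∣+∣q∣ (inside ∷ p)  (inside ∷ q)  =
  s≤s (≤-trans (∣p∪q∣≤∣p∣+∣q∣ p q) (+-monoʳ-≤ ∣ p ∣ (n≤1+n ∣ q ∣)))
∣p∪q∣≤∣p∣+∣q∣ (inside ∷ p)  (outside ∷ q) = s≤s (∣p∪q∣≤∣p∣+∣q∣ p q)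
∣p∪q∣≤∣p∣+∣q∣ (outside ∷ p) (inside ∷ q)  =
  subst (suc ∣ p ∪ q ∣ ≤_) (sym (+-suc ∣ p ∣ ∣ q ∣)) (s≤s (∣p∪q∣≤∣p∣+∣q∣ p q))
∣p∪q∣≤∣p∣+∣q∣ (outside ∷ p) (outside ∷ q) = ∣p∪q∣≤∣p∣+∣q∣ p q

∣image∣≤2 : ∀ {n m} (i v : Fin n) (t : Vec (Fin n) m) → image t ⊆ ⁅ v ⁆ →
            ∣ image (i ∷ t) ∣ ≤ 2
∣image∣≤2 i v t t⊆v = ≤-trans (∣p∪q∣≤∣p∣+∣q∣ ⁅ i ⁆ (image t))
  (+-mono-≤ (≤-reflexive (∣⁅x⁆∣≡1 i))
            (≤-trans (p⊆q⇒∣p∣≤∣q∣ t⊆v) (≤-reflexive (∣⁅x⁆∣≡1 v))))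

module _ {c ℓ} (R : CommutativeRing c ℓ) where
  open CommutativeRing R
    using (Carrier; _≈_; _*_; 0#; 1#; +-cong; +-identityˡ; *-congˡ; *-congʳ; zeroˡ; zeroʳ)
    renaming (refl to ≈-refl; sym to ≈-sym; trans to ≈-trans)

  adjTensor-nonEdge : ∀ {n k} (G : KGraph n k) (inv : Carrier) (t : Vec (Fin n) k) →
                      ∣ image t ∣ ≢ k → adjTensor R G inv t ≈ 0#
  adjTensor-nonEdge G inv t ∣t∣≢k with any? (λ e → ≡-dec _≟B_ (image t) e) (edges G)
  ... | yes t∈G = contradiction (All.lookup (edgesSize G) t∈G) ∣t∣≢k
  ... | no  _   = ≈-refl

  sumFin-zero : ∀ n (f : Fin n → Carrier) → (∀ j → f j ≈ 0#) → sumFin R n f ≈ 0#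
  sumFin-zero ℕ.zero  f f≈0 = ≈-refl
  sumFin-zero (suc n) f f≈0 =
    ≈-trans (+-cong (f≈0 Fin.zero) (sumFin-zero n _ (λ j → f≈0 (Fin.suc j)))) (+-identityˡ 0#)

  sumTuples-zero : ∀ {n} m (f : Vec (Fin n) m → Carrier) → (∀ t → f t ≈ 0#) →
                   sumTuples R m f ≈ 0#
  sumTuples-zero ℕ.zero  f f≈0 = f≈0 []
  sumTuples-zero {n} (suc m) f f≈0 =
    sumFin-zero n _ (λ j → sumTuples-zero m _ (λ t → f≈0 (j ∷ t)))

  unitVector : ∀ {n} → Fin n → Fin n → Carrier
  unitVector v i with v ≟ i
  ... | yes _ = 1#
  ... | no  _ = 0#

  prodTuple-unitVector : ∀ {n m} (v : Fin n) (t : Vec (Fin n) m) →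
                         prodTuple R (unitVector v) t ≈ 0# ⊎ image t ⊆ ⁅ v ⁆
  prodTuple-unitVector v []      = inj₂ ⊥⊆
  prodTuple-unitVector v (i ∷ t) with v ≟ i | prodTuple-unitVector v t
  ... | no  _    | _        = inj₁ (zeroˡ _)
  ... | yes _    | inj₁ t≈0 = inj₁ (≈-trans (*-congˡ t≈0) (zeroʳ 1#))
  ... | yes refl | inj₂ t⊆v = inj₂ λ x∈ → [ id , t⊆v ] (x∈p∪q⁻ ⁅ v ⁆ (image t) x∈)

  tensorApply-unitVector : ∀ {n k} (G : KGraph n (3 + k)) (inv : Carrier) (v i : Fin n) →
                           tensorApply R G inv (unitVector v) i ≈ 0#
  tensorApply-unitVector {k = k} G inv v i = sumTuples-zero _ _ term≈0
    where
    term≈0 : ∀ t → adjTensor R G inv (i ∷ t) * prodTuple R (unitVector v) t ≈ 0#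
    term≈0 t with prodTuple-unitVector v t
    ... | inj₁ t≈0 = ≈-trans (*-congˡ t≈0) (zeroʳ _)
    ... | inj₂ t⊆v = ≈-trans (*-congʳ (adjTensor-nonEdge G inv (i ∷ t) ∣it∣≢3+k)) (zeroˡ _)
      where
      ∣it∣≢3+k : ∣ image (i ∷ t) ∣ ≢ 3 + k
      ∣it∣≢3+k eq with subst (_≤ 2) eq (∣image∣≤2 i v t t⊆v)
      ... | s≤s (s≤s ())

  unitVector-nonzero : ∀ {n} → ¬ (1# ≈ 0#) → (v : Fin n) → ¬ (unitVector v v ≈ 0#)
  unitVector-nonzero 1≉0 v with v ≟ v
  ... | yes _  = 1≉0
  ... | no v≢v = contradiction refl v≢v

  zero-isEigenvalue : ∀ {n k} → ¬ (1# ≈ 0#) → Fin n → (G : KGraph n (3 + k)) (inv : Carrier) →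
                      IsEigenvalue R G inv 0#
  zero-isEigenvalue 1≉0 v G inv =
    unitVector v , (v , unitVector-nonzero 1≉0 v) ,
    λ i → ≈-trans (tensorApply-unitVector G inv v i) (≈-sym (zeroˡ _))

lemma3p11 : ∀ {c ℓ} (R : CommutativeRing c ℓ) →
    let open CommutativeRing R in
    ¬ (1# ≈ 0#) →
    {n k : ℕ} → 1 ≤ n → 3 ≤ k →
    (inv : Carrier) → inv * natR R ((pred k) !) ≈ 1# →
    (T : KGraph n k) → IsKTree T →
    IsEigenvalue R T inv 0#
lemma3p11 R 1≉0 {suc n} (s≤s z≤n) (s≤s (s≤s (s≤s _))) inv _ T _ =
  zero-isEigenvalue R 1≉0 Fin.zero T inv
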